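{- For all finite abstract simplicial complexes $G,H$ on disjoint vertex sets, $${\rm Dim}^+(G\oplus H)={\rm Dim}^+(G)+{\rm Dim}^+(H).$$
   Context: A finite abstract simplicial complex $G$ is a finite set of non-empty finite sets closed under taking non-empty subsets; $|G|$ denotes the number of its members. The average simplex cardinality is ${\rm Dim}^+(G)=\frac{1}{|G|+1}\sum_{x\in G}|x|$ (equivalently $f_G'(1)/f_G(1)$ with $f_G(t)=1+\sum_{x\in G}t^{|x|}$). The join of complexes on disjoint vertex sets is $G\oplus H=G\cup H\cup\{y\cup z: y\in G,z\in H\}$. -}

module Defs where

open import Data.Nat using (ℕ; suc; _<_)
open import Data.Integer using (+_)
open import Data.Rational using (ℚ; _/_)
open import Data.List using (List; []; length; map)
open import Data.Nat.ListAction using (sum)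
open import Data.List.Relation.Unary.All using (All)
open import Data.List.Relation.Unary.Linked using (Linked)
open import Data.List.Relation.Unary.Unique.Propositional using (Unique)
open import Data.List.Membership.Propositional using (_∈_)
open import Data.List.Relation.Binary.Subset.Propositional using (_⊆_)
open import Data.Product using (Σ; _×_)
open import Data.Sum using (_⊎_)
open import Relation.Binary.PropositionalEquality using (_≢_)
open import Function.Bundles using (_⇔_)

-- A finite set of vertices (vertices are natural numbers) is represented
-- canonically by a strictly increasing list, so that equality of finite
-- sets is propositional equality of lists.
FinSet : List ℕ → Set
FinSet = Linked _<_

record Complex : Set where
  field
    simplices : List (List ℕ)
    unique    : Unique simplices
    sets      : All FinSet simplices
    nonempty  : All (λ x → x ≢ []) simplices
    closed    : ∀ {x y} → x ∈ simplices → FinSet y → y ≢ [] → y ⊆ x →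
                y ∈ simplices
open Complex public

card : Complex → ℕ
card G = length (simplices G)

Dim⁺ : Complex → ℚ
Dim⁺ G = (+ sum (map length (simplices G))) / suc (card G)

_∈V_ : ℕ → Complex → Set
v ∈V G = Σ (List ℕ) λ x → x ∈ simplices G × v ∈ x

Disjoint : Complex → Complex → Set
Disjoint G H = ∀ v → v ∈V G → v ∈V H → Data.Empty.⊥
  where import Data.Empty

-- K is the join G ⊕ H = G ∪ H ∪ {y ∪ z : y ∈ G, z ∈ H}
-- (membership characterisation; members of K are canonical finite sets,
--  so x = y ∪ z is expressed elementwise)
IsJoin : Complex → Complex → Complex → Set
IsJoin G H K = ∀ x → (x ∈ simplices K) ⇔
  (x ∈ simplices G ⊎ x ∈ simplices H ⊎
   Σ (List ℕ) λ y → Σ (List ℕ) λ z →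
     y ∈ simplices G × z ∈ simplices H × FinSet x ×
     (∀ v → (v ∈ x) ⇔ (v ∈ y ⊎ v ∈ z)))

module Submission where

-- With the empty simplex adjoined, the faces of G ⊕ H are exactly the unions y ∪ z of a
-- face y of G and a face z of H, each arising from exactly one pair because the vertex
-- sets are disjoint. Hence the face polynomial is multiplicative, f_{G⊕H} = f_G f_H, and
-- Dim⁺ = f′(1)/f(1) is a logarithmic derivative, which turns products into sums. Only
-- f(1) = |G| + 1 (a length) and f′(1) = Σ|x| (a total size) enter, so the argument is a
-- count of the list of pairwise unions.

open import Defs
open import Data.Rational using (_+_)
open import Relation.Binary.PropositionalEquality using (_≡_)

open import Relation.Binary.PropositionalEquality
  using (refl; sym; trans; cong; cong₂; subst; setoid; module ≡-Reasoning)
open import Function.Base using (_∘_; id)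
open import Function.Bundles using (_⇔_; mk⇔; Equivalence)
open import Function.Construct.Symmetry using (⇔-sym)
open import Function.Construct.Composition using (_⇔-∘_)
open import Data.Empty using (⊥-elim)
open import Data.Product using (_×_; _,_; proj₁; proj₂)
open import Data.Sum using (_⊎_; inj₁; inj₂; [_,_])

open import Data.Nat as ℕ using (ℕ; suc; _≤?_)
open import Data.Nat.Properties
  using (<⇒≤; <⇒≢; ≤∧≢⇒<; ≤-trans; <-trans; ≤-decTotalOrder; ≤-totalOrder; *-comm)
open import Data.Nat.Solver using (module +-*-Solver)
open +-*-Solver using (solve; _:+_; _:*_; _:=_; con)
open import Data.Nat.ListAction using (sum)
open import Data.Nat.ListAction.Properties using (sum-↭; sum-++)
open import Data.Integer using (+_)
import Data.Integer as ℤ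
import Data.Integer.Properties as ℤ
open import Data.Rational using (ℚ; _/_; toℚᵘ; fromℚᵘ)
open import Data.Rational.Properties
  using (fromℚᵘ-toℚᵘ; toℚᵘ-fromℚᵘ; toℚᵘ-homo-+; fromℚᵘ-cong; /-cong)
import Data.Rational.Unnormalised as ℚᵘ
import Data.Rational.Unnormalised.Properties as ℚᵘ

open import Data.List using (List; []; _∷_; _++_; length; map; merge; cartesianProductWith)
open import Data.List.Properties using (length-++; length-map; map-++)
open import Data.List.Membership.Propositional using (_∈_)
open import Data.List.Membership.Propositional.Properties
  using (∈-++⁺ˡ; ∈-++⁺ʳ; ∈-++⁻; ∈-map⁻; ∈-cartesianProductWith⁺; ∈-cartesianProductWith⁻)
open import Data.List.Membership.Propositional.Properties.WithK using (unique∧set⇒bag)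
open import Data.List.Relation.Binary.BagAndSetEquality using (∼bag⇒↭)
open import Data.List.Relation.Binary.Disjoint.Propositional using ()
  renaming (Disjoint to DisjointLists)
open import Data.List.Relation.Binary.Permutation.Propositional using (_↭_; ↭-sym; ↭⇒↭ₛ)
open import Data.List.Relation.Binary.Permutation.Propositional.Properties
  using (merge-↭; ∈-resp-↭; ↭-length; map⁺)
open import Data.List.Relation.Binary.Permutation.Setoid.Properties (setoid ℕ) using (Unique-resp-↭)
open import Data.List.Relation.Binary.Pointwise using (Pointwise-≡⇒≡)
open import Data.List.Relation.Unary.Any using (here; there)
import Data.List.Relation.Unary.All as All
import Data.List.Relation.Unary.All.Properties as All
import Data.List.Relation.Unary.AllPairs as AllPairs
open import Data.List.Relation.Unary.AllPairs using ([]; _∷_)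
open import Data.List.Relation.Unary.Linked using (Linked)
open import Data.List.Relation.Unary.Linked.Properties using (AllPairs⇒Linked; Linked⇒AllPairs)
open import Data.List.Relation.Unary.Sorted.TotalOrder.Properties using (merge⁺; ↗↭↗⇒≋)
open import Data.List.Relation.Unary.Unique.Propositional using (Unique)
open import Data.List.Relation.Unary.Unique.Propositional.Properties using (++⁺)

-- Merging keeps duplicates, so this is the union only of disjoint sets; in exchange
-- length-∪ needs no hypothesis.
_∪_ : List ℕ → List ℕ → List ℕ
xs ∪ ys = merge _≤?_ xs ys

∪-↭ : ∀ xs ys → xs ∪ ys ↭ xs ++ ys
∪-↭ = merge-↭ _≤?_

∪-identityʳ : ∀ xs → xs ∪ [] ≡ xs
∪-identityʳ []       = refl
∪-identityʳ (_ ∷ _)  = refl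

∈-∪⁻ : ∀ xs ys {v} → v ∈ xs ∪ ys → v ∈ xs ⊎ v ∈ ys
∈-∪⁻ xs ys v∈ = ∈-++⁻ xs (∈-resp-↭ (∪-↭ xs ys) v∈)

∈-∪⁺ˡ : ∀ xs ys {v} → v ∈ xs → v ∈ xs ∪ ys
∈-∪⁺ˡ xs ys v∈ = ∈-resp-↭ (↭-sym (∪-↭ xs ys)) (∈-++⁺ˡ v∈)

∈-∪⁺ʳ : ∀ xs ys {v} → v ∈ ys → v ∈ xs ∪ ys
∈-∪⁺ʳ xs ys v∈ = ∈-resp-↭ (↭-sym (∪-↭ xs ys)) (∈-++⁺ʳ xs v∈)

∈-∪⇔ : ∀ xs ys v → (v ∈ xs ∪ ys) ⇔ (v ∈ xs ⊎ v ∈ ys)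
∈-∪⇔ xs ys v = mk⇔ (∈-∪⁻ xs ys) [ ∈-∪⁺ˡ xs ys , ∈-∪⁺ʳ xs ys ]

length-∪ : ∀ xs ys → length (xs ∪ ys) ≡ length xs ℕ.+ length ys
length-∪ xs ys = trans (↭-length (∪-↭ xs ys)) (length-++ xs)

FinSet⇒Unique : ∀ {xs} → FinSet xs → Unique xs
FinSet⇒Unique xs↗ = AllPairs.map <⇒≢ (Linked⇒AllPairs <-trans xs↗)

FinSet⇒Sorted : ∀ {xs} → FinSet xs → Linked ℕ._≤_ xs
FinSet⇒Sorted xs↗ = AllPairs⇒Linked (AllPairs.map <⇒≤ (Linked⇒AllPairs <-trans xs↗))

Sorted∧Unique⇒FinSet : ∀ {xs} → Linked ℕ._≤_ xs → Unique xs → FinSet xs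
Sorted∧Unique⇒FinSet xs≤ xs! =
  AllPairs⇒Linked (AllPairs.zipWith (λ (m≤n , m≢n) → ≤∧≢⇒< m≤n m≢n)
    (Linked⇒AllPairs ≤-trans xs≤ , xs!))

FinSet-∪ : ∀ {xs ys} → FinSet xs → FinSet ys → DisjointLists xs ys → FinSet (xs ∪ ys)
FinSet-∪ {xs} {ys} xs↗ ys↗ xs#ys = Sorted∧Unique⇒FinSet
  (merge⁺ ≤-decTotalOrder (FinSet⇒Sorted xs↗) (FinSet⇒Sorted ys↗))
  (Unique-resp-↭ (↭⇒↭ₛ (↭-sym (∪-↭ xs ys)))
    (++⁺ (FinSet⇒Unique xs↗) (FinSet⇒Unique ys↗) xs#ys))

FinSet-ext : ∀ {xs ys} → FinSet xs → FinSet ys → (∀ v → (v ∈ xs) ⇔ (v ∈ ys)) → xs ≡ ys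
FinSet-ext {xs} {ys} xs↗ ys↗ xs≈ys = Pointwise-≡⇒≡
  (↗↭↗⇒≋ ≤-totalOrder (FinSet⇒Sorted xs↗) (FinSet⇒Sorted ys↗) (↭⇒↭ₛ xs↭ys))
  where
  xs↭ys : xs ↭ ys
  xs↭ys = ∼bag⇒↭ (unique∧set⇒bag (FinSet⇒Unique xs↗) (FinSet⇒Unique ys↗) (xs≈ys _))

module _ {A B C : Set} where

  Unique-map⁺ : ∀ (f : B → C) {xs} → Unique xs →
    (∀ {x y} → x ∈ xs → y ∈ xs → f x ≡ f y → x ≡ y) → Unique (map f xs)
  Unique-map⁺ f {[]}     []          _   = []
  Unique-map⁺ f {x ∷ xs} (x∉ ∷ xs!) inj =
    All.map⁺ (All.tabulate λ y∈ fx≡fy → All.lookup x∉ y∈ (inj (here refl) (there y∈) fx≡fy))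
    ∷ Unique-map⁺ f xs! (λ y∈ z∈ → inj (there y∈) (there z∈))

  Unique-cartesianProductWith⁺ : ∀ (f : A → B → C) {xs ys} → Unique xs → Unique ys →
    (∀ {w x y z} → w ∈ xs → x ∈ xs → y ∈ ys → z ∈ ys → f w y ≡ f x z → w ≡ x × y ≡ z) →
    Unique (cartesianProductWith f xs ys)
  Unique-cartesianProductWith⁺ f {[]}     {ys} []         ys! inj = []
  Unique-cartesianProductWith⁺ f {x ∷ xs} {ys} (x∉ ∷ xs!) ys! inj = ++⁺
    (Unique-map⁺ (f x) ys! λ y∈ z∈ → proj₂ ∘ inj (here refl) (here refl) y∈ z∈)
    (Unique-cartesianProductWith⁺ f xs! ys! λ w∈ x∈ → inj (there w∈) (there x∈))
    disjoint
    where
    disjoint : DisjointLists (map (f x) ys) (cartesianProductWith f xs ys)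
    disjoint (v∈ , v∈′) with ∈-map⁻ (f x) v∈ | ∈-cartesianProductWith⁻ f xs ys v∈′
    ... | y , y∈ , refl | x′ , y′ , x′∈ , y′∈ , fxy≡fx′y′ =
      All.lookup x∉ x′∈ (proj₁ (inj (here refl) (there x′∈) y∈ y′∈ fxy≡fx′y′))

  length-cartesianProductWith : ∀ (f : A → B → C) xs ys →
    length (cartesianProductWith f xs ys) ≡ length xs ℕ.* length ys
  length-cartesianProductWith f []       ys = refl
  length-cartesianProductWith f (x ∷ xs) ys = begin
    length (map (f x) ys ++ cartesianProductWith f xs ys)        ≡⟨ length-++ (map (f x) ys) ⟩
    length (map (f x) ys) ℕ.+ length (cartesianProductWith f xs ys)
      ≡⟨ cong₂ ℕ._+_ (length-map (f x) ys) (length-cartesianProductWith f xs ys) ⟩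
    length ys ℕ.+ length xs ℕ.* length ys                       ∎
    where open ≡-Reasoning

_⊕_ : List (List ℕ) → List (List ℕ) → List (List ℕ)
xss ⊕ yss = cartesianProductWith _∪_ xss yss

totalSize : List (List ℕ) → ℕ
totalSize xss = sum (map length xss)

totalSize-++ : ∀ xss yss → totalSize (xss ++ yss) ≡ totalSize xss ℕ.+ totalSize yss
totalSize-++ xss yss =
  trans (cong sum (map-++ length xss yss)) (sum-++ (map length xss) (map length yss))

totalSize-map-∪ : ∀ xs yss → totalSize (map (xs ∪_) yss) ≡ length yss ℕ.* length xs ℕ.+ totalSize yss
totalSize-map-∪ xs []         = refl
totalSize-map-∪ xs (ys ∷ yss) = begin
  length (xs ∪ ys) ℕ.+ totalSize (map (xs ∪_) yss)
    ≡⟨ cong₂ ℕ._+_ (length-∪ xs ys) (totalSize-map-∪ xs yss) ⟩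
  (length xs ℕ.+ length ys) ℕ.+ (length yss ℕ.* length xs ℕ.+ totalSize yss)
    ≡⟨ solve 4 (λ a b n t → (a :+ b) :+ (n :* a :+ t) := (a :+ n :* a) :+ (b :+ t)) refl
         (length xs) (length ys) (length yss) (totalSize yss) ⟩
  (length xs ℕ.+ length yss ℕ.* length xs) ℕ.+ (length ys ℕ.+ totalSize yss) ∎
  where open ≡-Reasoning

totalSize-⊕ : ∀ xss yss →
  totalSize (xss ⊕ yss) ≡ totalSize xss ℕ.* length yss ℕ.+ length xss ℕ.* totalSize yss
totalSize-⊕ []         yss = refl
totalSize-⊕ (xs ∷ xss) yss = begin
  totalSize (map (xs ∪_) yss ++ xss ⊕ yss)
    ≡⟨ totalSize-++ (map (xs ∪_) yss) _ ⟩
  totalSize (map (xs ∪_) yss) ℕ.+ totalSize (xss ⊕ yss)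
    ≡⟨ cong₂ ℕ._+_ (totalSize-map-∪ xs yss) (totalSize-⊕ xss yss) ⟩
  (n ℕ.* a ℕ.+ t) ℕ.+ (s ℕ.* n ℕ.+ m ℕ.* t)
    ≡⟨ solve 5 (λ a n t s m → (n :* a :+ t) :+ (s :* n :+ m :* t) := (a :+ s) :* n :+ (con 1 :+ m) :* t) refl
         a n t s m ⟩
  (a ℕ.+ s) ℕ.* n ℕ.+ suc m ℕ.* t ∎
  where
  open ≡-Reasoning
  a n t s m : ℕ
  a = length xs
  n = length yss
  t = totalSize yss
  s = totalSize xss
  m = length xss

/-+-/ : ∀ m n c d →
  (+ m) / suc c + (+ n) / suc d ≡ (+ (m ℕ.* suc d ℕ.+ suc c ℕ.* n)) / (suc c ℕ.* suc d)
/-+-/ m n c d = begin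
  p + q                                                       ≡⟨ fromℚᵘ-toℚᵘ (p + q) ⟨
  fromℚᵘ (toℚᵘ (p + q))                                       ≡⟨ fromℚᵘ-cong toℚᵘ-p+q ⟩
  fromℚᵘ (ℚᵘ.mkℚᵘ (+ m) c ℚᵘ.+ ℚᵘ.mkℚᵘ (+ n) d)                ≡⟨ /-cong numerator refl ⟩
  (+ (m ℕ.* suc d ℕ.+ suc c ℕ.* n)) / (suc c ℕ.* suc d)        ∎
  where
  open ≡-Reasoning
  p q : ℚ
  p = (+ m) / suc c
  q = (+ n) / suc d
  toℚᵘ-p+q : toℚᵘ (p + q) ℚᵘ.≃ ℚᵘ.mkℚᵘ (+ m) c ℚᵘ.+ ℚᵘ.mkℚᵘ (+ n) d
  toℚᵘ-p+q = ℚᵘ.≃-trans (toℚᵘ-homo-+ p q)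
    (ℚᵘ.+-cong (toℚᵘ-fromℚᵘ (ℚᵘ.mkℚᵘ (+ m) c)) (toℚᵘ-fromℚᵘ (ℚᵘ.mkℚᵘ (+ n) d)))
  numerator : + m ℤ.* + suc d ℤ.+ + n ℤ.* + suc c ≡ + (m ℕ.* suc d ℕ.+ suc c ℕ.* n)
  numerator = begin
    + m ℤ.* + suc d ℤ.+ + n ℤ.* + suc c        ≡⟨ cong₂ ℤ._+_ (ℤ.pos-* m (suc d)) (ℤ.pos-* n (suc c)) ⟨
    + (m ℕ.* suc d) ℤ.+ + (n ℕ.* suc c)        ≡⟨ ℤ.pos-+ (m ℕ.* suc d) (n ℕ.* suc c) ⟨
    + (m ℕ.* suc d ℕ.+ n ℕ.* suc c)            ≡⟨ cong (λ k → + (m ℕ.* suc d ℕ.+ k)) (*-comm n (suc c)) ⟩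
    + (m ℕ.* suc d ℕ.+ suc c ℕ.* n)            ∎

augmented : Complex → List (List ℕ)
augmented G = [] ∷ simplices G

augmented-FinSet : ∀ G {x} → x ∈ augmented G → FinSet x
augmented-FinSet G (here refl) = Linked.[]
augmented-FinSet G (there x∈G) = All.lookup (sets G) x∈G

augmented-Unique : ∀ G → Unique (augmented G)
augmented-Unique G =
  All.tabulate (λ x∈G []≡x → All.lookup (nonempty G) x∈G (sym []≡x)) ∷ unique G

augmented-vertex : ∀ G {x v} → x ∈ augmented G → v ∈ x → v ∈V G
augmented-vertex G (here refl) ()
augmented-vertex G (there x∈G) v∈x = _ , x∈G , v∈x

module Join (G H K : Complex) (G#H : Disjoint G H) (join : IsJoin G H K) where

  augmented-disjoint : ∀ {y z} → y ∈ augmented G → z ∈ augmented H → DisjointLists y z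
  augmented-disjoint y∈ z∈ (v∈y , v∈z) =
    G#H _ (augmented-vertex G y∈ v∈y) (augmented-vertex H z∈ v∈z)

  FinSet-augmented-∪ : ∀ {y z} → y ∈ augmented G → z ∈ augmented H → FinSet (y ∪ z)
  FinSet-augmented-∪ y∈ z∈ =
    FinSet-∪ (augmented-FinSet G y∈) (augmented-FinSet H z∈) (augmented-disjoint y∈ z∈)

  ∪-injective : ∀ {y y′ z z′} → y ∈ augmented G → y′ ∈ augmented G →
    z ∈ augmented H → z′ ∈ augmented H → y ∪ z ≡ y′ ∪ z′ → y ≡ y′ × z ≡ z′
  ∪-injective {y} {y′} {z} {z′} y∈ y′∈ z∈ z′∈ eq =
    FinSet-ext (augmented-FinSet G y∈) (augmented-FinSet G y′∈)
      (λ _ → mk⇔ (left y∈ z′∈ eq) (left y′∈ z∈ (sym eq))) ,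
    FinSet-ext (augmented-FinSet H z∈) (augmented-FinSet H z′∈)
      (λ _ → mk⇔ (right {y = y} y′∈ z∈ eq) (right {y = y′} y∈ z′∈ (sym eq)))
    where
    left : ∀ {y y′ z z′ v} → y ∈ augmented G → z′ ∈ augmented H → y ∪ z ≡ y′ ∪ z′ → v ∈ y → v ∈ y′
    left {y} {y′} {z} {z′} y∈ z′∈ eq v∈y =
      [ id , (λ v∈z′ → ⊥-elim (augmented-disjoint y∈ z′∈ (v∈y , v∈z′))) ]
        (∈-∪⁻ y′ z′ (subst (_ ∈_) eq (∈-∪⁺ˡ y z v∈y)))
    right : ∀ {y y′ z z′ v} → y′ ∈ augmented G → z ∈ augmented H → y ∪ z ≡ y′ ∪ z′ → v ∈ z → v ∈ z′
    right {y} {y′} {z} {z′} y′∈ z∈ eq v∈z =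
      [ (λ v∈y′ → ⊥-elim (augmented-disjoint y′∈ z∈ (v∈y′ , v∈z))) , id ]
        (∈-∪⁻ y′ z′ (subst (_ ∈_) eq (∈-∪⁺ʳ y z v∈z)))

  ∪-∈-⊕ : ∀ {y z} → y ∈ augmented G → z ∈ augmented H → y ∪ z ∈ augmented G ⊕ augmented H
  ∪-∈-⊕ = ∈-cartesianProductWith⁺ _∪_

  augmented-join⁺ : ∀ {x} → x ∈ augmented K → x ∈ augmented G ⊕ augmented H
  augmented-join⁺ (here refl) = ∪-∈-⊕ (here refl) (here refl)
  augmented-join⁺ {x} (there x∈K) with Equivalence.to (join x) x∈K
  ... | inj₁ x∈G =
    subst (_∈ augmented G ⊕ augmented H) (∪-identityʳ x) (∪-∈-⊕ (there x∈G) (here refl))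
  ... | inj₂ (inj₁ x∈H) = ∪-∈-⊕ (here refl) (there x∈H)
  ... | inj₂ (inj₂ (y , z , y∈G , z∈H , x↗ , x≈y∪z)) =
    subst (_∈ augmented G ⊕ augmented H) (sym x≡y∪z) (∪-∈-⊕ (there y∈G) (there z∈H))
    where
    x≡y∪z : x ≡ y ∪ z
    x≡y∪z = FinSet-ext x↗ (FinSet-augmented-∪ (there y∈G) (there z∈H))
      λ v → ⇔-sym (∈-∪⇔ y z v) ⇔-∘ x≈y∪z v

  augmented-join⁻ : ∀ {x} → x ∈ augmented G ⊕ augmented H → x ∈ augmented K
  augmented-join⁻ x∈P with ∈-cartesianProductWith⁻ _∪_ (augmented G) (augmented H) x∈P
  ... | [] , [] , here refl , here refl , refl = here refl
  ... | [] , z , here refl , there z∈H , refl = there (Equivalence.from (join z) (inj₂ (inj₁ z∈H)))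
  ... | y , [] , there y∈G , here refl , refl =
    subst (_∈ augmented K) (sym (∪-identityʳ y)) (there (Equivalence.from (join y) (inj₁ y∈G)))
  ... | y , z , there y∈G , there z∈H , refl = there (Equivalence.from (join (y ∪ z))
    (inj₂ (inj₂ (y , z , y∈G , z∈H , FinSet-augmented-∪ (there y∈G) (there z∈H) , ∈-∪⇔ y z))))

  augmented-join-↭ : augmented K ↭ augmented G ⊕ augmented H
  augmented-join-↭ = ∼bag⇒↭ (unique∧set⇒bag (augmented-Unique K)
    (Unique-cartesianProductWith⁺ _∪_ (augmented-Unique G) (augmented-Unique H) ∪-injective)
    (mk⇔ augmented-join⁺ augmented-join⁻))

  card-join : suc (card K) ≡ suc (card G) ℕ.* suc (card H)
  card-join = trans (↭-length augmented-join-↭)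
    (length-cartesianProductWith _∪_ (augmented G) (augmented H))

  totalSize-join : totalSize (simplices K) ≡
    totalSize (simplices G) ℕ.* suc (card H) ℕ.+ suc (card G) ℕ.* totalSize (simplices H)
  totalSize-join = trans (sum-↭ (map⁺ length augmented-join-↭))
    (totalSize-⊕ (augmented G) (augmented H))

mainTheorem5 : (G H K : Complex) → Disjoint G H → IsJoin G H K →
    Dim⁺ K ≡ Dim⁺ G + Dim⁺ H
mainTheorem5 G H K G#H join = begin
  Dim⁺ K                                         ≡⟨ /-cong (cong +_ totalSize-join) card-join ⟩
  (+ (σG ℕ.* suc h ℕ.+ suc g ℕ.* σH)) / (suc g ℕ.* suc h) ≡⟨ /-+-/ σG σH g h ⟨
  Dim⁺ G + Dim⁺ H                                ∎
  where
  open ≡-Reasoning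
  open Join G H K G#H join
  g h σG σH : ℕ
  g  = card G
  h  = card H
  σG = totalSize (simplices G)
  σH = totalSize (simplices H)
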